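{- Let $m,n\ge 1$ and let $r$ be a positive integer with at most 3 distinct prime factors. Let $\alpha$ be an edge labeling of $G^*_{m,n}$ over $\mathbb{Z}_r$ such that $(G^*_{m,n},\alpha)$ has rank one. Then the number of edges of $G^*_{m,n}$ labeled $(0)$ is at least (i) $6mn-1$ if $r=p^a$; (ii) $3mn+m+n-2$ if $r=p_1^{a_1}p_2^{a_2}$; (iii) $2m+2n-3$ if $r=p_1^{a_1}p_2^{a_2}p_3^{a_3}$, where $p,p_1,p_2,p_3$ denote distinct primes and $a,a_i\ge 1$.
   Context: $G_{m,n}$ is the planar subdivision obtained from an $m\times n$ rectangular grid of squares by dividing each square into two triangles by a diagonal and then subdividing each triangle by a Clough–Tocher refinement (joining an interior point of the triangle to its three vertices, producing three triangles). It has $6mn$ triangular regions. $G^*_{m,n}$ is its dual graph ignoring the exterior region: the vertices are the $6mn$ triangular regions, and two vertices are joined by an edge when the regions share an interior edge of $G_{m,n}$; $G^*_{m,n}$ has $9mn-m-n$ edges. An edge labeling of a graph $G=(V,E)$ over a commutative ring $R$ is a function from $E$ to the set of ideals of $R$; a spline is a function $p:V\to R$ with $p(u)-p(v)\in\alpha(uv)$ for every edge $uv$; $(G,\alpha)$ has rank one if every spline is constant (takes the same value at every vertex). -}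

module Defs where

open import Data.Nat using (ℕ; zero; suc; _+_; _*_; _∸_; NonZero; pred)
open import Data.Nat.DivMod using (_mod_)
open import Data.Fin using (Fin; toℕ; inject₁) renaming (zero to fzero; suc to fsuc)
open import Data.Bool using (Bool; true)
open import Data.Product using (Σ; _×_; _,_)
open import Function.Definitions using (Injective)
open import Relation.Binary.PropositionalEquality using (_≡_)

module ZMod (r : ℕ) .{{_ : NonZero r}} where

  Zr : Set
  Zr = Fin r

  0r : Zr
  0r = 0 mod r

  _+r_ : Zr → Zr → Zr
  x +r y = (toℕ x + toℕ y) mod r

  _*r_ : Zr → Zr → Zr
  x *r y = (toℕ x * toℕ y) mod r

  -r_ : Zr → Zr
  -r x = (r ∸ toℕ x) mod r

  _-r_ : Zr → Zr → Zr
  x -r y = x +r (-r y)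

  -- An ideal of ℤ_r: an (additive) subgroup closed under multiplication
  -- by ring elements.  Since ℤ_r is finite, membership is given as a
  -- Bool-valued (i.e. decidable) subset.
  record Ideal : Set where
    field
      mem    : Zr → Bool
      zero∈  : mem 0r ≡ true
      +∈     : ∀ x y → mem x ≡ true → mem y ≡ true → mem (x +r y) ≡ true
      -∈     : ∀ x → mem x ≡ true → mem (-r x) ≡ true
      *∈     : ∀ a x → mem x ≡ true → mem (a *r x) ≡ true

  _∈_ : Zr → Ideal → Set
  x ∈ I = Ideal.mem I x ≡ true

  IsZeroIdeal : Ideal → Set
  IsZeroIdeal I = ∀ x → x ∈ I → x ≡ 0r

-- Square (i , j) (column i < m, row j < n) has corners (i,j),(i+1,j),
-- (i+1,j+1),(i,j+1) and is cut by the diagonal (i,j)–(i+1,j+1) into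
--   L = lower-right triangle (bottom, right, diagonal edges)
--   U = upper-left  triangle (left, top, diagonal edges).
-- The Clough–Tocher split of each triangle gives one subtriangle per
-- edge of the triangle:  Lb, Lr, Ld  and  Ul, Ut, Ud.

data Tri : Set where
  Lb Lr Ld Ul Ut Ud : Tri

Vert : ℕ → ℕ → Set
Vert m n = Fin m × Fin n × Tri

data InnerKind : Set where
  LbLr LrLd LdLb UlUt UtUd UdUl LdUd : InnerKind

innerEnds : InnerKind → Tri × Tri
innerEnds LbLr = Lb , Lr
innerEnds LrLd = Lr , Ld
innerEnds LdLb = Ld , Lb
innerEnds UlUt = Ul , Ut
innerEnds UtUd = Ut , Ud
innerEnds UdUl = Ud , Ul
innerEnds LdUd = Ld , Ud

lo : ∀ {k} → Fin (pred k) → Fin k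
lo {suc k} i = inject₁ i

hi : ∀ {k} → Fin (pred k) → Fin k
hi {suc k} i = fsuc i

data Edge (m n : ℕ) : Set where
  inner : Fin m → Fin n → InnerKind → Edge m n
  horiz : Fin (pred m) → Fin n → Edge m n
  vert  : Fin m → Fin (pred n) → Edge m n

ends : ∀ {m n} → Edge m n → Vert m n × Vert m n
ends (inner i j k) with innerEnds k
... | s , t = (i , j , s) , (i , j , t)
ends (horiz i j) = (lo i , j , Lr) , (hi i , j , Ul)
ends (vert i j)  = (i , lo j , Ut) , (i , hi j , Lb)

module _ (r : ℕ) .{{_ : NonZero r}} where
  open ZMod r

  Labeling : ℕ → ℕ → Set
  Labeling m n = Edge m n → Ideal

  IsSpline : ∀ {m n} → Labeling m n → (Vert m n → Zr) → Set
  IsSpline α p = ∀ e → let (u , v) = ends e in (p u -r p v) ∈ α e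

  RankOne : ∀ {m n} → Labeling m n → Set
  RankOne {m} {n} α = ∀ (p : Vert m n → Zr) → IsSpline α p → ∀ u v → p u ≡ p v

  AtLeastZeroEdges : ∀ {m n} → Labeling m n → ℕ → Set
  AtLeastZeroEdges {m} {n} α k =
    Σ (Fin k → Edge m n) λ f → Injective _≡_ _≡_ f × (∀ i → IsZeroIdeal (α (f i)))

-- Fix a nonzero residue c. If the edges whose label does not contain c split the
-- vertices into two nonempty sides, then c on one side and 0 on the other is a
-- nonconstant spline; so under rank one those edges form a connected spanning
-- subgraph and number at least N − 1, where N = 6mn is the number of vertices.
-- Take as test residues the cofactors r/p, one for each of the k prime divisors
-- p of r: every nonzero ideal of ℤ_r contains one of them (it contains
-- gcd(x, r) for each of its elements x), so an edge whose label avoids all k of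
-- them is labeled (0), and every other edge avoids at most k − 1 of them.
-- Double counting the pairs (test residue, avoiding edge) among the E = 9mn − m − n
-- edges gives k(N − 1) ≤ kZ + (k − 1)(E − Z), i.e. Z ≥ k(N − 1) − (k − 1)E for the
-- number Z of zero edges; for k = 1, 2, 3 this is the claimed bound.

module Submission where

open import Defs
open import Data.Nat using (ℕ; _+_; _*_; _∸_; _^_; _≤_; NonZero)
open import Data.Nat.Primality using (Prime)
open import Data.Product using (_×_)
open import Relation.Binary.PropositionalEquality using (_≡_; _≢_)

open import Data.Nat using (suc; s≤s; z≤n)
open import Data.Nat.Tactic.RingSolver using (solve-∀)
open import Data.Product using (_,_)

module ListCounting where

  open import Level using (0ℓ)
  open import Algebra.Properties.CommutativeSemigroup using (interchange)
  open import Data.Fin as Fin using (Fin; inject≤)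
  open import Data.Fin.Properties using (injective⇒≤; inject≤-injective)
  open import Data.List using (List; []; _∷_; length; filter; lookup; map; allFin)
  open import Data.List.Properties using (length-map; length-tabulate; filter-all)
  open import Data.List.Membership.Propositional using (_∈_)
  open import Data.List.Membership.Propositional.Properties using (∈-lookup; ∈-map⁺; ∈-allFin)
  open import Data.List.Membership.Setoid.Properties using (index-injective)
  open import Data.List.Relation.Binary.Subset.Propositional using (_⊆_)
  open import Data.List.Relation.Unary.All as All using (All; []; _∷_; all?; universal)
  open import Data.List.Relation.Unary.AllPairs using (_∷_)
  open import Data.List.Relation.Unary.Any using (index)
  open import Data.List.Relation.Unary.Unique.Propositional using (Unique)
  open import Data.List.Relation.Unary.Unique.Propositional.Properties using (map⁺; allFin⁺)
  open import Data.Nat using (ℕ; suc; _+_; _*_; _≤_; z≤n; s≤s)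
  open import Data.Nat.Properties
    using (+-mono-≤; +-monoˡ-≤; +-monoʳ-≤; ≤-refl; ≤-reflexive; +-assoc; +-commutativeSemigroup; module ≤-Reasoning)
  open import Data.Nat.Tactic.RingSolver using (solve-∀)
  open import Data.Product using (Σ; _×_; _,_)
  open import Function.Bundles using (_↔_; Inverse)
  open import Function.Definitions using (Injective)
  open import Relation.Binary.PropositionalEquality using (_≡_; refl; sym; trans; cong; cong₂; subst; setoid)
  open import Relation.Nullary using (Dec; yes; no; contradiction)
  open import Relation.Unary using (Pred; Decidable)

  private variable A : Set

  count : {P : Pred A 0ℓ} → Decidable P → List A → ℕ
  count P? xs = length (filter P? xs)

  lookup-injective : {xs : List A} → Unique xs → Injective _≡_ _≡_ (lookup xs)
  lookup-injective {xs = _ ∷ _} _        {Fin.zero}  {Fin.zero}  _  = refl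
  lookup-injective {xs = _ ∷ _} (x∉ ∷ _) {Fin.zero}  {Fin.suc j} eq = contradiction eq (All.lookup x∉ (∈-lookup j))
  lookup-injective {xs = _ ∷ _} (x∉ ∷ _) {Fin.suc i} {Fin.zero}  eq = contradiction (sym eq) (All.lookup x∉ (∈-lookup i))
  lookup-injective {xs = _ ∷ _} (_ ∷ u)  {Fin.suc i} {Fin.suc j} eq = cong Fin.suc (lookup-injective u eq)

  Unique-⊆⇒length≤ : {xs ys : List A} → Unique xs → xs ⊆ ys → length xs ≤ length ys
  Unique-⊆⇒length≤ {A = A} {xs} {ys} xs! xs⊆ys = injective⇒≤ position-injective
    where
    position : Fin (length xs) → Fin (length ys)
    position i = index (xs⊆ys (∈-lookup i))

    position-injective : Injective _≡_ _≡_ position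
    position-injective eq =
      lookup-injective xs! (index-injective (setoid A) (xs⊆ys (∈-lookup _)) (xs⊆ys (∈-lookup _)) eq)

  injection-into-list : (xs : List A) → Unique xs → ∀ {k} → k ≤ length xs →
                        Σ (Fin k → A) λ f → Injective _≡_ _≡_ f × (∀ i → f i ∈ xs)
  injection-into-list xs xs! k≤ =
    (λ i → lookup xs (inject≤ i k≤)) ,
    (λ eq → inject≤-injective k≤ k≤ _ _ (lookup-injective xs! eq)) ,
    (λ i → ∈-lookup (inject≤ i k≤))

  [_] : {P : Set} → Dec P → ℕ
  [ yes _ ] = 1
  [ no _ ]  = 0

  count-∷ : {P : Pred A 0ℓ} (P? : Decidable P) (x : A) (xs : List A) →
            count P? (x ∷ xs) ≡ [ P? x ] + count P? xs
  count-∷ P? x xs with P? x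
  ... | yes _ = refl
  ... | no _  = refl

  count-inclusion-exclusion : {P Q R : Pred A 0ℓ} (P? : Decidable P) (Q? : Decidable Q) (R? : Decidable R) →
                              (∀ {x} → P x → Q x → R x) →
                              ∀ xs → count P? xs + count Q? xs ≤ length xs + count R? xs
  count-inclusion-exclusion P? Q? R? PQ⇒R [] = z≤n
  count-inclusion-exclusion P? Q? R? PQ⇒R (x ∷ xs) = begin
    count P? (x ∷ xs) + count Q? (x ∷ xs)
      ≡⟨ cong₂ _+_ (count-∷ P? x xs) (count-∷ Q? x xs) ⟩
    ([ P? x ] + count P? xs) + ([ Q? x ] + count Q? xs)
      ≡⟨ interchange +-commutativeSemigroup [ P? x ] (count P? xs) [ Q? x ] (count Q? xs) ⟩
    ([ P? x ] + [ Q? x ]) + (count P? xs + count Q? xs)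
      ≤⟨ +-mono-≤ pointwise (count-inclusion-exclusion P? Q? R? PQ⇒R xs) ⟩
    (1 + [ R? x ]) + (length xs + count R? xs)
      ≡⟨ interchange +-commutativeSemigroup 1 [ R? x ] (length xs) (count R? xs) ⟩
    length (x ∷ xs) + ([ R? x ] + count R? xs)
      ≡⟨ cong (length (x ∷ xs) +_) (count-∷ R? x xs) ⟨
    length (x ∷ xs) + count R? (x ∷ xs) ∎
    where
    open ≤-Reasoning
    pointwise : [ P? x ] + [ Q? x ] ≤ 1 + [ R? x ]
    pointwise with P? x | Q? x | R? x
    ... | yes px | yes qx | no ¬rx = contradiction (PQ⇒R px qx) ¬rx
    ... | yes _  | yes _  | yes _  = ≤-refl
    ... | yes _  | no _   | _      = s≤s z≤n
    ... | no _   | yes _  | _      = s≤s z≤n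
    ... | no _   | no _   | _      = z≤n

  module _ {C : Set} {P : C → Pred A 0ℓ} (P? : ∀ c → Decidable (P c)) where

    AllOf : List C → Pred A 0ℓ
    AllOf cs x = All (λ c → P c x) cs

    allOf? : ∀ cs → Decidable (AllOf cs)
    allOf? cs x = all? (λ c → P? c x) cs

    count-allOf-lower-bound : ∀ {N} cs xs → All (λ c → N ≤ suc (count (P? c) xs)) cs →
                              length cs * N + length xs ≤ length cs + length cs * length xs + count (allOf? cs) xs
    count-allOf-lower-bound [] xs [] =
      ≤-reflexive (cong length (sym (filter-all (allOf? []) (universal (λ _ → []) xs))))
    count-allOf-lower-bound {N} (c ∷ cs) xs (N≤ ∷ N≤s) = begin
      (N + k * N) + E
        ≡⟨ +-assoc N (k * N) E ⟩
      N + (k * N + E)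
        ≤⟨ +-mono-≤ N≤ (count-allOf-lower-bound cs xs N≤s) ⟩
      suc (count (P? c) xs) + (k + k * E + count (allOf? cs) xs)
        ≡⟨ regroup (count (P? c) xs) k E (count (allOf? cs) xs) ⟩
      suc k + (count (P? c) xs + count (allOf? cs) xs) + k * E
        ≤⟨ +-monoˡ-≤ (k * E) (+-monoʳ-≤ (suc k) (count-inclusion-exclusion (P? c) (allOf? cs) (allOf? (c ∷ cs)) _∷_ xs)) ⟩
      suc k + (E + count (allOf? (c ∷ cs)) xs) + k * E
        ≡⟨ regroup′ k E (count (allOf? (c ∷ cs)) xs) ⟩
      suc k + (E + k * E) + count (allOf? (c ∷ cs)) xs ∎
      where
      open ≤-Reasoning
      k E : ℕ
      k = length cs
      E = length xs
      regroup : ∀ p k e z → suc p + (k + k * e + z) ≡ suc k + (p + z) + k * e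
      regroup = solve-∀
      regroup′ : ∀ k e z → suc k + (e + z) + k * e ≡ suc k + (e + k * e) + z
      regroup′ = solve-∀

  module _ {n : ℕ} (A↔Fin : A ↔ Fin n) where
    open Inverse A↔Fin

    enumerate : List A
    enumerate = map from (allFin n)

    enumerate-unique : Unique enumerate
    enumerate-unique = map⁺ from-injective (allFin⁺ n)
      where
      from-injective : Injective _≡_ _≡_ from
      from-injective {i} {j} eq = trans (sym (strictlyInverseˡ i)) (trans (cong to eq) (strictlyInverseˡ j))

    ∈-enumerate : ∀ x → x ∈ enumerate
    ∈-enumerate x = subst (_∈ enumerate) (strictlyInverseʳ x) (∈-map⁺ from (∈-allFin (to x)))

    length-enumerate : length enumerate ≡ n
    length-enumerate = trans (length-map from (allFin n)) (length-tabulate (λ i → i))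

module SpanningTrees where

  open import Level using (0ℓ)
  open import Data.Bool using (Bool)
  open import Data.Empty using (⊥-elim)
  open import Data.Fin as Fin using (Fin)
  open import Data.List using (List; []; _∷_; length)
  open import Data.List.Membership.Propositional using (_∈_; _∉_; lose)
  open import Data.List.Membership.Propositional.Properties using (∈-filter⁺)
  open import Data.List.Relation.Unary.All as All using (All; []; _∷_; all?)
  open import Data.List.Relation.Unary.All.Properties using (¬All⇒Any¬; ¬Any⇒All¬)
  open import Data.List.Relation.Unary.AllPairs using ([]; _∷_)
  open import Data.List.Relation.Unary.Any using (here; there; any?; satisfied)
  open import Data.List.Relation.Unary.Unique.Propositional using (Unique)
  open import Data.Nat using (ℕ; zero; suc; _+_; _≤_; z≤n; s≤s)
  open import Data.Nat.Properties using (≤-trans; ≤-reflexive; +-suc; m≤m+n)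
  open import Data.Product using (Σ; ∃; _×_; _,_; proj₁; proj₂)
  open import Data.Sum using (_⊎_; inj₁; inj₂)
  open import Function.Bundles using (_↔_)
  open import Function.Properties.Inverse using (Inverse⇒Injection)
  open import Relation.Binary.Definitions using (DecidableEquality)
  open import Relation.Binary.PropositionalEquality using (_≡_; _≢_; refl; sym; trans; cong; subst)
  open import Relation.Nullary using (yes; no; ¬?; does)
  open import Relation.Nullary.Decidable using (via-injection; dec-true; dec-false; _×-dec_; _⊎-dec_)
  open import Relation.Unary using (Pred; Decidable)

  open ListCounting

  module _ {V E : Set} {N : ℕ} (V↔Fin : V ↔ Fin N) (ends : E → V × V) where

    src tgt : E → V
    src e = proj₁ (ends e)
    tgt e = proj₂ (ends e)

    CutConnected : Pred E 0ℓ → Set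
    CutConnected P = ∀ (side : V → Bool) → (∀ e → P e → side (src e) ≡ side (tgt e)) → ∀ u v → side u ≡ side v

    private
      _≟_ : DecidableEquality V
      _≟_ = via-injection (Inverse⇒Injection V↔Fin) Fin._≟_

      open import Data.List.Membership.DecPropositional _≟_ using (_∈?_)

    module _ {P : Pred E 0ℓ} (P? : Decidable P) (es : List E) (∈-es : ∀ e → e ∈ es)
             (connected : CutConnected P) where

      record Tree : Set where
        field
          reached        : List V
          edges          : List E
          reached-unique : Unique reached
          edges-unique   : Unique edges
          edges-P        : All P edges
          edges-inside   : All (λ e → src e ∈ reached × tgt e ∈ reached) edges
          size           : length reached ≡ suc (length edges)
      open Tree

      singleton : V → Tree
      singleton v = record
        { reached = v ∷ [] ; edges = [] ; reached-unique = [] ∷ [] ; edges-unique = []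
        ; edges-P = [] ; edges-inside = [] ; size = refl }

      reached-bound : (t : Tree) → length (reached t) ≤ suc (count P? es)
      reached-bound t = subst (_≤ suc (count P? es)) (sym (size t))
        (s≤s (Unique-⊆⇒length≤ (edges-unique t) (λ e∈ → ∈-filter⁺ P? (∈-es _) (All.lookup (edges-P t) e∈))))

      nonempty : ∀ (R : List V) {k} → length R ≡ suc k → ∃ (_∈ R)
      nonempty (w ∷ _) _ = w , here refl

      Crossing : List V → Pred E 0ℓ
      Crossing R e = P e × ((src e ∈ R × tgt e ∉ R) ⊎ (src e ∉ R × tgt e ∈ R))

      crossing? : ∀ R → Decidable (Crossing R)
      crossing? R e = P? e ×-dec ((src e ∈? R ×-dec ¬? (tgt e ∈? R)) ⊎-dec (¬? (src e ∈? R) ×-dec tgt e ∈? R))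

      -- Otherwise membership in the reached set is a nonconstant side function respected by all P-edges.
      crossing-edge : (t : Tree) → ∀ {v} → v ∉ reached t → ∃ (Crossing (reached t))
      crossing-edge t {v} v∉R with any? (crossing? (reached t)) es
      ... | yes crossing   = satisfied crossing
      ... | no no-crossing = ⊥-elim (root≢v (connected side uncut root v))
        where
        R : List V
        R = reached t
        side : V → Bool
        side w = does (w ∈? R)
        uncut : ∀ e → P e → side (src e) ≡ side (tgt e)
        uncut e pe with src e ∈? R | tgt e ∈? R
        ... | yes _  | yes _  = refl
        ... | no _   | no _   = refl
        ... | yes s∈ | no t∉  = ⊥-elim (no-crossing (lose (∈-es e) (pe , inj₁ (s∈ , t∉))))
        ... | no s∉  | yes t∈ = ⊥-elim (no-crossing (lose (∈-es e) (pe , inj₂ (s∉ , t∈))))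
        root : V
        root = proj₁ (nonempty R (size t))
        root≢v : side root ≢ side v
        root≢v eq with () ← trans (sym (dec-true (root ∈? R) (proj₂ (nonempty R (size t)))))
                                  (trans eq (dec-false (v ∈? R) v∉R))

      extend : (t : Tree) (e : E) → P e → (w : V) → w ∉ reached t →
               src e ∈ w ∷ reached t → tgt e ∈ w ∷ reached t → e ∉ edges t → Tree
      extend t e pe w w∉ s∈ t∈ e∉ = record
        { reached        = w ∷ reached t
        ; edges          = e ∷ edges t
        ; reached-unique = ¬Any⇒All¬ _ w∉ ∷ reached-unique t
        ; edges-unique   = ¬Any⇒All¬ _ e∉ ∷ edges-unique t
        ; edges-P        = pe ∷ edges-P t
        ; edges-inside   = (s∈ , t∈) ∷ All.map (λ (s∈ , t∈) → there s∈ , there t∈) (edges-inside t)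
        ; size           = cong suc (size t)
        }

      extend-across : (t : Tree) → ∀ {e} → Crossing (reached t) e →
                      Σ Tree λ t′ → length (reached t′) ≡ suc (length (reached t))
      extend-across t {e} (pe , inj₁ (s∈ , t∉)) =
        extend t e pe (tgt e) t∉ (there s∈) (here refl) (λ e∈ → t∉ (proj₂ (All.lookup (edges-inside t) e∈))) , refl
      extend-across t {e} (pe , inj₂ (s∉ , t∈)) =
        extend t e pe (src e) s∉ (here refl) (there t∈) (λ e∈ → s∉ (proj₁ (All.lookup (edges-inside t) e∈))) , refl

      vertices : List V
      vertices = enumerate V↔Fin

      grow : ∀ fuel (t : Tree) → N ≤ fuel + length (reached t) → N ≤ suc (count P? es)
      grow zero t N≤ = ≤-trans N≤ (reached-bound t)
      grow (suc fuel) t N≤ with all? (_∈? reached t) vertices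
      ... | yes all-reached = ≤-trans (≤-reflexive (sym (length-enumerate V↔Fin)))
            (≤-trans (Unique-⊆⇒length≤ (enumerate-unique V↔Fin) (All.lookup all-reached)) (reached-bound t))
      ... | no missing with v , v∉ ← satisfied (¬All⇒Any¬ (_∈? reached t) vertices missing)
                       with t′ , longer ← extend-across t (proj₂ (crossing-edge t v∉)) =
        grow fuel t′ (subst (N ≤_) (trans (sym (+-suc fuel _)) (cong (fuel +_) (sym longer))) N≤)

      cutConnected⇒spanning : N ≤ suc (count P? es)
      cutConnected⇒spanning = from-vertices vertices refl
        where
        from-vertices : ∀ vs → vs ≡ vertices → N ≤ suc (count P? es)
        from-vertices []      eq = ≤-trans (≤-reflexive (trans (sym (length-enumerate V↔Fin)) (cong length (sym eq)))) z≤n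
        from-vertices (v ∷ _) _  = grow N (singleton v) (m≤m+n N 1)

module PrimeDivisors where

  open import Data.List using ([]; _∷_)
  open import Data.List.Relation.Unary.All using (_∷_)
  open import Data.Nat using (zero; suc; _*_; _^_; _<_; s≤s; z≤n)
  open import Data.Nat.Divisibility using (_∣_; m∣m*n; ∣1⇒≡1)
  open import Data.Nat.ListAction using (product)
  open import Data.Nat.Primality using (Prime; euclidsLemma; prime⇒irreducible; ¬prime[1])
  open import Data.Nat.Primality.Factorisation using (factorise)
  open import Data.Nat.Properties using (<-irrefl; +-identityʳ)
  open import Data.Product using (∃; _×_; _,_)
  open import Data.Sum using (inj₁; inj₂)
  open import Relation.Binary.PropositionalEquality using (_≡_; refl; sym; subst)
  open import Relation.Nullary using (contradiction)

  quotient>1 : ∀ {r t d} → d < r → r ≡ t * d → 1 < t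
  quotient>1 {t = zero}         d<0 refl = contradiction d<0 λ ()
  quotient>1 {t = suc zero} {d} d<r r≡d  = contradiction (subst (d <_) r≡d d<r) (<-irrefl (sym (+-identityʳ d)))
  quotient>1 {t = suc (suc _)}  _   _    = s≤s (s≤s z≤n)

  prime-divisor : ∀ t → 1 < t → ∃ λ q → Prime q × q ∣ t
  prime-divisor (suc zero) (s≤s ())
  prime-divisor t@(suc (suc _)) _ with factorise t
  ... | record { factors = [] ; isFactorisation = () }
  ... | record { factors = q ∷ fs ; isFactorisation = t≡ ; factorsPrime = q-prime ∷ _ } =
    q , q-prime , subst (q ∣_) (sym t≡) (m∣m*n (product fs))

  prime∣p^a⇒≡p : ∀ {p q} a → Prime p → Prime q → q ∣ p ^ a → q ≡ p
  prime∣p^a⇒≡p zero _ q-prime q∣1 = contradiction (subst Prime (∣1⇒≡1 q∣1) q-prime) ¬prime[1]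
  prime∣p^a⇒≡p {p} (suc a) p-prime q-prime q∣p^a with euclidsLemma p (p ^ a) q-prime q∣p^a
  ... | inj₂ q∣p^a′ = prime∣p^a⇒≡p a p-prime q-prime q∣p^a′
  ... | inj₁ q∣p with prime⇒irreducible p-prime q∣p
  ...   | inj₁ q≡1 = contradiction (subst Prime q≡1 q-prime) ¬prime[1]
  ...   | inj₂ q≡p = q≡p

module IdealsOfZMod where

  open import Data.Fin as Fin using (Fin; toℕ)
  open import Data.Fin.Properties using (toℕ-fromℕ<; toℕ-injective; toℕ<n)
  open import Data.List using (List; map)
  open import Data.List.Membership.Propositional using (find)
  open import Data.List.Relation.Unary.All as All using (All)
  import Data.List.Relation.Unary.All.Properties as All
  open import Data.List.Relation.Unary.Any using (Any)
  open import Data.Nat using (ℕ; suc; _+_; _*_; _∸_; _≤_; _<_; NonZero; ≢-nonZero; ≢-nonZero⁻¹; pred; _%_; nonTrivial⇒n>1)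
  open import Data.Nat.DivMod using (_mod_; %-distribˡ-+; %-distribˡ-*; n%n≡0; m<n⇒m%n≡m; [m+kn]%n≡m%n)
  open import Data.Nat.Divisibility using (_∣_; divides; ∣⇒≤)
  open import Data.Nat.GCD using (gcd; gcd-GCD; gcd[m,n]∣m; gcd[m,n]∣n; module Bézout)
  open import Data.Nat.Primality using (Prime; prime⇒nonZero; prime⇒nonTrivial)
  open import Data.Nat.Properties using (m+[n∸m]≡n; <⇒≤; *-cancelʳ-≡; m<m*n; ≤-<-trans; n≢0⇒n>0; *-assoc)
  open import Data.Nat.Tactic.RingSolver using (solve-∀)
  open import Data.Product using (∃; _×_; _,_; proj₂)
  open import Relation.Binary.PropositionalEquality using (_≡_; _≢_; refl; sym; trans; cong; cong₂; subst; module ≡-Reasoning)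
  open import Relation.Nullary using (¬_; yes; no; contradiction)

  open PrimeDivisors

  d+m≡k*n⇒[pred-n*m]%n≡d%n : ∀ n .{{_ : NonZero n}} d m k → d + m ≡ k * n → (pred n * m) % n ≡ d % n
  d+m≡k*n⇒[pred-n*m]%n≡d%n (suc n) d m k eq = begin
    (n * m) % suc n              ≡⟨ [m+kn]%n≡m%n (n * m) k (suc n) ⟨
    (n * m + k * suc n) % suc n  ≡⟨ cong (λ z → (n * m + z) % suc n) eq ⟨
    (n * m + (d + m)) % suc n    ≡⟨ cong (_% suc n) (regroup n d m) ⟩
    (d + m * suc n) % suc n      ≡⟨ [m+kn]%n≡m%n d m (suc n) ⟩
    d % suc n                    ∎
    where
    open ≡-Reasoning
    regroup : ∀ n d m → n * m + (d + m) ≡ d + m * suc n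
    regroup = solve-∀

  module _ (r : ℕ) .{{_ : NonZero r}} where
    open ZMod r

    toℕ-mod : ∀ k → toℕ (k mod r) ≡ k % r
    toℕ-mod k = toℕ-fromℕ< _

    %≡⇒mod≡ : ∀ {a b} → a % r ≡ b % r → a mod r ≡ b mod r
    %≡⇒mod≡ eq = toℕ-injective (trans (toℕ-mod _) (trans eq (sym (toℕ-mod _))))

    toℕ-mod-identity : ∀ (x : Zr) → toℕ x mod r ≡ x
    toℕ-mod-identity x = toℕ-injective (trans (toℕ-mod _) (m<n⇒m%n≡m (toℕ<n x)))

    0%r≡0 : 0 % r ≡ 0
    0%r≡0 = m<n⇒m%n≡m (n≢0⇒n>0 (≢-nonZero⁻¹ r))

    toℕ-0r : toℕ 0r ≡ 0
    toℕ-0r = trans (toℕ-mod 0) 0%r≡0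

    mod-+r : ∀ a b → (a mod r) +r (b mod r) ≡ (a + b) mod r
    mod-+r a b = %≡⇒mod≡ (trans (cong₂ (λ u v → (u + v) % r) (toℕ-mod a) (toℕ-mod b)) (sym (%-distribˡ-+ a b r)))

    mod-*r : ∀ a b → (a mod r) *r (b mod r) ≡ (a * b) mod r
    mod-*r a b = %≡⇒mod≡ (trans (cong₂ (λ u v → (u * v) % r) (toℕ-mod a) (toℕ-mod b)) (sym (%-distribˡ-* a b r)))

    -r-self : ∀ x → x -r x ≡ 0r
    -r-self x = begin
      x -r x                                ≡⟨ cong (_+r (-r x)) (sym (toℕ-mod-identity x)) ⟩
      (toℕ x mod r) +r ((r ∸ toℕ x) mod r)  ≡⟨ mod-+r (toℕ x) (r ∸ toℕ x) ⟩
      (toℕ x + (r ∸ toℕ x)) mod r           ≡⟨ cong (_mod r) (m+[n∸m]≡n (<⇒≤ (toℕ<n x))) ⟩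
      r mod r                               ≡⟨ %≡⇒mod≡ (trans (n%n≡0 r) (sym 0%r≡0)) ⟩
      0r                                    ∎
      where open ≡-Reasoning

    ∈-diff : ∀ {x y} (I : Ideal) → x ∈ I → y ∈ I → (x -r y) ∈ I
    ∈-diff I x∈ y∈ = Ideal.+∈ I _ _ x∈ (Ideal.-∈ I _ y∈)

    ∈-self-diff : ∀ x (I : Ideal) → (x -r x) ∈ I
    ∈-self-diff x I = subst (_∈ I) (sym (-r-self x)) (Ideal.zero∈ I)

    ∈-multiple : ∀ (I : Ideal) a {b} → (b mod r) ∈ I → ((a * b) mod r) ∈ I
    ∈-multiple I a {b} b∈ = subst (_∈ I) (mod-*r a b) (Ideal.*∈ I (a mod r) (b mod r) b∈)

    bézout-mod : ∀ x → ∃ λ a → (a * x) mod r ≡ gcd x r mod r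
    bézout-mod x with Bézout.identity (gcd-GCD x r)
    ... | Bézout.+- a k eq = a , %≡⇒mod≡ (trans (cong (_% r) (sym eq)) ([m+kn]%n≡m%n (gcd x r) k r))
    ... | Bézout.-+ a k eq = pred r * a , %≡⇒mod≡
            (trans (cong (_% r) (*-assoc (pred r) a x)) (d+m≡k*n⇒[pred-n*m]%n≡d%n r (gcd x r) (a * x) k eq))

    ∈-gcd : ∀ (I : Ideal) {x} → x ∈ I → (gcd (toℕ x) r mod r) ∈ I
    ∈-gcd I {x} x∈ with a , a*x≡gcd ← bézout-mod (toℕ x) =
      subst (_∈ I) a*x≡gcd (∈-multiple I a (subst (_∈ I) (sym (toℕ-mod-identity x)) x∈))

    proper-divisor-∋-cofactor : ∀ (I : Ideal) {d} → (d mod r) ∈ I → d < r → d ∣ r →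
                                ∃ λ q → Prime q × q ∣ r × (∀ s → r ≡ s * q → (s mod r) ∈ I)
    proper-divisor-∋-cofactor I {d} d∈ d<r (divides t r≡td) with prime-divisor t (quotient>1 d<r r≡td)
    ... | q , q-prime , divides u t≡uq = q , q-prime , divides (u * d) r≡[ud]q , cofactor∈
      where
      regroup : ∀ u q d → u * q * d ≡ u * d * q
      regroup = solve-∀
      r≡[ud]q : r ≡ u * d * q
      r≡[ud]q = trans r≡td (trans (cong (_* d) t≡uq) (regroup u q d))
      cofactor∈ : ∀ s → r ≡ s * q → (s mod r) ∈ I
      cofactor∈ s r≡sq = subst (λ k → (k mod r) ∈ I) (sym s≡ud) (∈-multiple I u d∈)
        where
        s≡ud : s ≡ u * d
        s≡ud = *-cancelʳ-≡ s (u * d) q {{prime⇒nonZero q-prime}} (trans (sym r≡sq) r≡[ud]q)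

    nonzero-ideal-∋-cofactor : ∀ (I : Ideal) {x} → x ∈ I → x ≢ 0r →
                               ∃ λ q → Prime q × q ∣ r × (∀ s → r ≡ s * q → (s mod r) ∈ I)
    nonzero-ideal-∋-cofactor I {x} x∈ x≢0 =
      proper-divisor-∋-cofactor I (∈-gcd I x∈) (≤-<-trans gcd≤x (toℕ<n x)) (gcd[m,n]∣n (toℕ x) r)
      where
      x≢0′ : toℕ x ≢ 0
      x≢0′ x≡0 = x≢0 (toℕ-injective (trans x≡0 (sym toℕ-0r)))
      gcd≤x : gcd (toℕ x) r ≤ toℕ x
      gcd≤x = ∣⇒≤ {{≢-nonZero x≢0′}} (gcd[m,n]∣m (toℕ x) r)

    cofactor≢0r : ∀ {p s} → Prime p → r ≡ s * p → s mod r ≢ 0r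
    cofactor≢0r {p} {s} p-prime r≡sp s≡0 =
      s≢0 (trans (sym (m<n⇒m%n≡m s<r)) (trans (sym (toℕ-mod s)) (trans (cong toℕ s≡0) toℕ-0r)))
      where
      s≢0 : s ≢ 0
      s≢0 refl = ≢-nonZero⁻¹ r r≡sp
      s<r : s < r
      s<r = subst (s <_) (sym r≡sp) (m<m*n s p {{≢-nonZero s≢0}} (nonTrivial⇒n>1 p {{prime⇒nonTrivial p-prime}}))

    record Detecting (cs : List Zr) : Set where
      field
        nonzero : All (_≢ 0r) cs
        detects : ∀ (I : Ideal) → All (λ c → ¬ c ∈ I) cs → IsZeroIdeal I

    Cofactor : ℕ × ℕ → Set
    Cofactor (p , s) = Prime p × r ≡ s * p

    Covers : List (ℕ × ℕ) → Set
    Covers ps = ∀ q → Prime q → q ∣ r → Any (λ (p , _) → q ≡ p) ps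

    cofactors-detecting : ∀ ps → All Cofactor ps → Covers ps → Detecting (map (λ (_ , s) → s mod r) ps)
    cofactors-detecting ps cofactors covers = record
      { nonzero = All.map⁺ (All.map (λ (p-prime , r≡sp) → cofactor≢0r p-prime r≡sp) cofactors)
      ; detects = zero-ideal
      }
      where
      zero-ideal : ∀ I → All (λ c → ¬ c ∈ I) (map (λ (_ , s) → s mod r) ps) → IsZeroIdeal I
      zero-ideal I none x x∈ with x Fin.≟ 0r
      ... | yes x≡0 = x≡0
      ... | no x≢0 with q , q-prime , q∣r , cofactor∈ ← nonzero-ideal-∋-cofactor I x∈ x≢0
                   with (_ , s) , ps∈ , refl ← find (covers q q-prime q∣r) =
        contradiction (cofactor∈ s (proj₂ (All.lookup cofactors ps∈))) (All.lookup (All.map⁻ none) ps∈)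

module PrimeCofactors where

  open import Data.List using (List; []; _∷_)
  open import Data.List.Relation.Unary.All using ([]; _∷_)
  open import Data.List.Relation.Unary.Any using (here; there)
  open import Data.Nat using (ℕ; suc; pred; _*_; _^_; _≤_; NonZero)
  open import Data.Nat.DivMod using (_mod_)
  open import Data.Nat.Divisibility using (_∣_)
  open import Data.Nat.Primality using (Prime; euclidsLemma)
  open import Data.Nat.Properties using (*-comm)
  open import Data.Nat.Tactic.RingSolver using (solve-∀)
  open import Data.Product using (_×_; _,_)
  open import Data.Sum using (inj₁; inj₂)
  open import Relation.Binary.PropositionalEquality using (_≡_; trans; subst)

  open PrimeDivisors
  open IdealsOfZMod

  module _ (r : ℕ) .{{_ : NonZero r}} where

    prime-power-detecting : ∀ {p} a → Prime p → 1 ≤ a → r ≡ p ^ a → Detecting r ((p ^ pred a) mod r ∷ [])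
    prime-power-detecting {p} (suc a) p-prime _ r≡ =
      cofactors-detecting r ((p , p ^ a) ∷ []) ((p-prime , trans r≡ (*-comm p (p ^ a))) ∷ []) covers
      where
      covers : Covers r ((p , p ^ a) ∷ [])
      covers q q-prime q∣r = here (prime∣p^a⇒≡p (suc a) p-prime q-prime (subst (q ∣_) r≡ q∣r))

    two-primes-detecting : ∀ {p₁ p₂} a₁ a₂ → Prime p₁ → Prime p₂ → 1 ≤ a₁ → 1 ≤ a₂ → r ≡ p₁ ^ a₁ * p₂ ^ a₂ →
                           Detecting r ((p₁ ^ pred a₁ * p₂ ^ a₂) mod r ∷ (p₁ ^ a₁ * p₂ ^ pred a₂) mod r ∷ [])
    two-primes-detecting {p₁} {p₂} (suc a₁) (suc a₂) p₁-prime p₂-prime _ _ r≡ =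
      cofactors-detecting r ps
        ( (p₁-prime , trans r≡ (first  p₁ (p₁ ^ a₁) (p₂ ^ suc a₂)))
        ∷ (p₂-prime , trans r≡ (second p₂ (p₁ ^ suc a₁) (p₂ ^ a₂))) ∷ [])
        covers
      where
      ps : List (ℕ × ℕ)
      ps = (p₁ , p₁ ^ a₁ * p₂ ^ suc a₂) ∷ (p₂ , p₁ ^ suc a₁ * p₂ ^ a₂) ∷ []
      first : ∀ p x y → p * x * y ≡ x * y * p
      first = solve-∀
      second : ∀ p x y → x * (p * y) ≡ x * y * p
      second = solve-∀
      covers : Covers r ps
      covers q q-prime q∣r with euclidsLemma (p₁ ^ suc a₁) (p₂ ^ suc a₂) q-prime (subst (q ∣_) r≡ q∣r)
      ... | inj₁ q∣P₁ = here (prime∣p^a⇒≡p (suc a₁) p₁-prime q-prime q∣P₁)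
      ... | inj₂ q∣P₂ = there (here (prime∣p^a⇒≡p (suc a₂) p₂-prime q-prime q∣P₂))

    three-primes-detecting : ∀ {p₁ p₂ p₃} a₁ a₂ a₃ → Prime p₁ → Prime p₂ → Prime p₃ → 1 ≤ a₁ → 1 ≤ a₂ → 1 ≤ a₃ →
                             r ≡ p₁ ^ a₁ * p₂ ^ a₂ * p₃ ^ a₃ →
                             Detecting r ( (p₁ ^ pred a₁ * p₂ ^ a₂ * p₃ ^ a₃) mod r
                                         ∷ (p₁ ^ a₁ * p₂ ^ pred a₂ * p₃ ^ a₃) mod r
                                         ∷ (p₁ ^ a₁ * p₂ ^ a₂ * p₃ ^ pred a₃) mod r ∷ [])
    three-primes-detecting {p₁} {p₂} {p₃} (suc a₁) (suc a₂) (suc a₃) p₁-prime p₂-prime p₃-prime _ _ _ r≡ =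
      cofactors-detecting r ps
        ( (p₁-prime , trans r≡ (first  p₁ (p₁ ^ a₁) (p₂ ^ suc a₂) (p₃ ^ suc a₃)))
        ∷ (p₂-prime , trans r≡ (second p₂ (p₁ ^ suc a₁) (p₂ ^ a₂) (p₃ ^ suc a₃)))
        ∷ (p₃-prime , trans r≡ (third  p₃ (p₁ ^ suc a₁) (p₂ ^ suc a₂) (p₃ ^ a₃))) ∷ [])
        covers
      where
      ps : List (ℕ × ℕ)
      ps = (p₁ , p₁ ^ a₁ * p₂ ^ suc a₂ * p₃ ^ suc a₃)
         ∷ (p₂ , p₁ ^ suc a₁ * p₂ ^ a₂ * p₃ ^ suc a₃)
         ∷ (p₃ , p₁ ^ suc a₁ * p₂ ^ suc a₂ * p₃ ^ a₃) ∷ []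
      first : ∀ p x y z → p * x * y * z ≡ x * y * z * p
      first = solve-∀
      second : ∀ p x y z → x * (p * y) * z ≡ x * y * z * p
      second = solve-∀
      third : ∀ p x y z → x * y * (p * z) ≡ x * y * z * p
      third = solve-∀
      covers : Covers r ps
      covers q q-prime q∣r with euclidsLemma (p₁ ^ suc a₁ * p₂ ^ suc a₂) (p₃ ^ suc a₃) q-prime (subst (q ∣_) r≡ q∣r)
      ... | inj₂ q∣P₃ = there (there (here (prime∣p^a⇒≡p (suc a₃) p₃-prime q-prime q∣P₃)))
      ... | inj₁ q∣P₁P₂ with euclidsLemma (p₁ ^ suc a₁) (p₂ ^ suc a₂) q-prime q∣P₁P₂
      ...   | inj₁ q∣P₁ = here (prime∣p^a⇒≡p (suc a₁) p₁-prime q-prime q∣P₁)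
      ...   | inj₂ q∣P₂ = there (here (prime∣p^a⇒≡p (suc a₂) p₂-prime q-prime q∣P₂))

module GridEnumeration where

  open import Data.Fin using (Fin; zero; suc; #_)
  open import Data.Fin.Properties using (*↔×; +↔⊎)
  open import Data.Nat using (ℕ; _+_; _*_; pred)
  open import Data.Product using (_×_; _,_)
  open import Data.Product.Function.NonDependent.Propositional using (_×-↔_)
  open import Data.Sum using (_⊎_; inj₁; inj₂)
  open import Data.Sum.Function.Propositional using (_⊎-↔_)
  open import Function.Bundles using (_↔_; mk↔ₛ′)
  open import Function.Properties.Inverse using (↔-refl; ↔-sym; ↔-trans)
  open import Relation.Binary.PropositionalEquality using (_≡_; refl)

  Tri↔Fin6 : Tri ↔ Fin 6
  Tri↔Fin6 = mk↔ₛ′ to from to-from from-to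
    where
    to : Tri → Fin 6
    to Lb = # 0
    to Lr = # 1
    to Ld = # 2
    to Ul = # 3
    to Ut = # 4
    to Ud = # 5
    from : Fin 6 → Tri
    from zero = Lb
    from (suc zero) = Lr
    from (suc (suc zero)) = Ld
    from (suc (suc (suc zero))) = Ul
    from (suc (suc (suc (suc zero)))) = Ut
    from (suc (suc (suc (suc (suc zero))))) = Ud
    to-from : ∀ i → to (from i) ≡ i
    to-from zero = refl
    to-from (suc zero) = refl
    to-from (suc (suc zero)) = refl
    to-from (suc (suc (suc zero))) = refl
    to-from (suc (suc (suc (suc zero)))) = refl
    to-from (suc (suc (suc (suc (suc zero))))) = refl
    from-to : ∀ t → from (to t) ≡ t
    from-to Lb = refl
    from-to Lr = refl
    from-to Ld = refl
    from-to Ul = refl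
    from-to Ut = refl
    from-to Ud = refl

  InnerKind↔Fin7 : InnerKind ↔ Fin 7
  InnerKind↔Fin7 = mk↔ₛ′ to from to-from from-to
    where
    to : InnerKind → Fin 7
    to LbLr = # 0
    to LrLd = # 1
    to LdLb = # 2
    to UlUt = # 3
    to UtUd = # 4
    to UdUl = # 5
    to LdUd = # 6
    from : Fin 7 → InnerKind
    from zero = LbLr
    from (suc zero) = LrLd
    from (suc (suc zero)) = LdLb
    from (suc (suc (suc zero))) = UlUt
    from (suc (suc (suc (suc zero)))) = UtUd
    from (suc (suc (suc (suc (suc zero))))) = UdUl
    from (suc (suc (suc (suc (suc (suc zero)))))) = LdUd
    to-from : ∀ i → to (from i) ≡ i
    to-from zero = refl
    to-from (suc zero) = refl
    to-from (suc (suc zero)) = refl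
    to-from (suc (suc (suc zero))) = refl
    to-from (suc (suc (suc (suc zero)))) = refl
    to-from (suc (suc (suc (suc (suc zero))))) = refl
    to-from (suc (suc (suc (suc (suc (suc zero)))))) = refl
    from-to : ∀ t → from (to t) ≡ t
    from-to LbLr = refl
    from-to LrLd = refl
    from-to LdLb = refl
    from-to UlUt = refl
    from-to UtUd = refl
    from-to UdUl = refl
    from-to LdUd = refl

  vertex-count edge-count : ℕ → ℕ → ℕ
  vertex-count m n = m * (n * 6)
  edge-count   m n = m * (n * 7) + (pred m * n + m * pred n)

  module _ {m n : ℕ} where

    cells↔Fin : ∀ {A : Set} {k} → A ↔ Fin k → (Fin m × Fin n × A) ↔ Fin (m * (n * k))
    cells↔Fin A↔Fin = ↔-trans (↔-refl ×-↔ (↔-refl ×-↔ A↔Fin)) (↔-trans (↔-refl ×-↔ ↔-sym *↔×) (↔-sym *↔×))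

    Vert↔Fin : Vert m n ↔ Fin (vertex-count m n)
    Vert↔Fin = cells↔Fin Tri↔Fin6

    EdgeCode : Set
    EdgeCode = (Fin m × Fin n × InnerKind) ⊎ ((Fin (pred m) × Fin n) ⊎ (Fin m × Fin (pred n)))

    Edge↔EdgeCode : Edge m n ↔ EdgeCode
    Edge↔EdgeCode = mk↔ₛ′ to from to-from from-to
      where
      to : Edge m n → EdgeCode
      to (inner i j k) = inj₁ (i , j , k)
      to (horiz i j)   = inj₂ (inj₁ (i , j))
      to (vert i j)    = inj₂ (inj₂ (i , j))
      from : EdgeCode → Edge m n
      from (inj₁ (i , j , k))     = inner i j k
      from (inj₂ (inj₁ (i , j))) = horiz i j
      from (inj₂ (inj₂ (i , j))) = vert i j
      to-from : ∀ x → to (from x) ≡ x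
      to-from (inj₁ _)        = refl
      to-from (inj₂ (inj₁ _)) = refl
      to-from (inj₂ (inj₂ _)) = refl
      from-to : ∀ e → from (to e) ≡ e
      from-to (inner _ _ _) = refl
      from-to (horiz _ _)   = refl
      from-to (vert _ _)    = refl

    Edge↔Fin : Edge m n ↔ Fin (edge-count m n)
    Edge↔Fin = ↔-trans Edge↔EdgeCode (↔-trans (cells↔Fin InnerKind↔Fin7 ⊎-↔ (↔-sym *↔× ⊎-↔ ↔-sym *↔×))
                                              (↔-trans (↔-refl ⊎-↔ ↔-sym +↔⊎) (↔-sym +↔⊎)))

module RankOneBound where

  open import Level using (0ℓ)
  open import Data.Bool using (true; false; if_then_else_)
  import Data.Bool.Properties as Bool
  open import Data.List using (List; length; filter)
  open import Data.List.Membership.Propositional.Properties using (∈-filter⁻)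
  open import Data.List.Relation.Unary.All as All using ()
  open import Data.List.Relation.Unary.Unique.Propositional.Properties using (filter⁺)
  open import Data.Nat using (ℕ; suc; _+_; _*_; _∸_; _≤_; NonZero)
  open import Data.Nat.Properties using (+-cancelʳ-≤; m≤n+o⇒m∸n≤o; module ≤-Reasoning)
  open import Data.Nat.Tactic.RingSolver using (solve-∀)
  open import Data.Product using (_,_; proj₁; proj₂)
  open import Relation.Binary.PropositionalEquality using (_≡_; _≢_; refl; sym; subst)
  open import Relation.Nullary using (¬_; yes; no; ¬?; contradiction)
  open import Relation.Unary using (Pred; Decidable)

  open ListCounting
  open SpanningTrees
  open IdealsOfZMod
  open GridEnumeration

  module _ (r : ℕ) .{{_ : NonZero r}} {m n : ℕ} (α : Labeling r m n) where
    open ZMod r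

    Avoids : Zr → Pred (Edge m n) 0ℓ
    Avoids c e = ¬ c ∈ α e

    avoids? : ∀ c → Decidable (Avoids c)
    avoids? c e = ¬? (Ideal.mem (α e) c Bool.≟ true)

    rankOne⇒cutConnected : RankOne r α → ∀ {c} → c ≢ 0r → CutConnected Vert↔Fin ends (Avoids c)
    rankOne⇒cutConnected rank-one {c} c≢0 side uncut u v = scaled-injective (rank-one scaled isSpline u v)
      where
      scaled : Vert m n → Zr
      scaled w = if side w then c else 0r
      scaled-∈ : ∀ I → c ∈ I → ∀ w → scaled w ∈ I
      scaled-∈ I c∈ w with side w
      ... | true  = c∈
      ... | false = Ideal.zero∈ I
      isSpline : IsSpline r α scaled
      isSpline e with Ideal.mem (α e) c Bool.≟ true
      ... | yes c∈ = ∈-diff r (α e) (scaled-∈ (α e) c∈ (proj₁ (ends e))) (scaled-∈ (α e) c∈ (proj₂ (ends e)))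
      ... | no c∉  = subst (λ b → (scaled (proj₁ (ends e)) -r (if b then c else 0r)) ∈ α e) (uncut e c∉)
                           (∈-self-diff r (scaled (proj₁ (ends e))) (α e))
      scaled-injective : ∀ {a b} → (if a then c else 0r) ≡ (if b then c else 0r) → a ≡ b
      scaled-injective {true}  {true}  _  = refl
      scaled-injective {false} {false} _  = refl
      scaled-injective {true}  {false} eq = contradiction eq c≢0
      scaled-injective {false} {true}  eq = contradiction (sym eq) c≢0

    module _ (rank-one : RankOne r α) {cs : List Zr} (detecting : Detecting r cs) where

      edges : List (Edge m n)
      edges = enumerate Edge↔Fin

      avoiding-all : ℕ
      avoiding-all = count (allOf? avoids? cs) edges

      count-avoiding-all : length cs * vertex-count m n + edge-count m n ≤
                           length cs + length cs * edge-count m n + avoiding-all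
      count-avoiding-all =
        subst (λ E → length cs * vertex-count m n + E ≤ length cs + length cs * E + avoiding-all)
          (length-enumerate (Edge↔Fin {m} {n}))
          (count-allOf-lower-bound avoids? cs edges (All.map spanning (Detecting.nonzero detecting)))
        where
        spanning : ∀ {c} → c ≢ 0r → vertex-count m n ≤ suc (count (avoids? c) edges)
        spanning c≢0 =
          cutConnected⇒spanning Vert↔Fin ends (avoids? _) edges (∈-enumerate (Edge↔Fin {m} {n})) (rankOne⇒cutConnected rank-one c≢0)

      zero-edges : ∀ {K} → K ≤ avoiding-all → AtLeastZeroEdges r α K
      zero-edges K≤
        with f , f-injective , f∈ ← injection-into-list (filter (allOf? avoids? cs) edges)
                                      (filter⁺ (allOf? avoids? cs) (enumerate-unique (Edge↔Fin {m} {n}))) K≤ =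
        f , f-injective , λ i → Detecting.detects detecting (α (f i)) (proj₂ (∈-filter⁻ (allOf? avoids? cs) {xs = edges} (f∈ i)))

      zero-edges-lower-bound : ∀ B → B + length cs * edge-count m n ≡ length cs * vertex-count m n + edge-count m n →
                               AtLeastZeroEdges r α (B ∸ length cs)
      zero-edges-lower-bound B identity = zero-edges (m≤n+o⇒m∸n≤o B k (+-cancelʳ-≤ (k * E) B (k + Z) (begin
        B + k * E      ≡⟨ identity ⟩
        k * N + E      ≤⟨ count-avoiding-all ⟩
        k + k * E + Z  ≡⟨ regroup k E Z ⟩
        k + Z + k * E  ∎)))
        where
        open ≤-Reasoning
        k N E Z : ℕ
        k = length cs
        N = vertex-count m n
        E = edge-count m n
        Z = avoiding-all
        regroup : ∀ k e z → k + k * e + z ≡ k + z + k * e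
        regroup = solve-∀

open PrimeCofactors
open RankOneBound

-- Here E = edge-count m n = 9mn − m − n and m * (n * 6) = vertex-count m n = N; each identity
-- reads B + k E ≡ k N + E for the bound B of the case with k primes.
prime-power-counts : ∀ a b → let m = suc a ; n = suc b ; E = m * (n * 7) + (a * n + m * b) in
                     6 * m * n + 1 * E ≡ 1 * (m * (n * 6)) + E
prime-power-counts = solve-∀

two-primes-counts : ∀ a b → let m = suc a ; n = suc b ; E = m * (n * 7) + (a * n + m * b) in
                    3 * m * n + m + n + 2 * E ≡ 2 * (m * (n * 6)) + E
two-primes-counts = solve-∀

three-primes-counts : ∀ a b → let m = suc a ; n = suc b ; E = m * (n * 7) + (a * n + m * b) in
                      2 * m + 2 * n + 3 * E ≡ 3 * (m * (n * 6)) + E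
three-primes-counts = solve-∀

-- The primes need not be distinct: a repeated prime merely repeats a test residue.
proposition5p1 : (m n r : ℕ) → .{{_ : NonZero r}} → 1 ≤ m → 1 ≤ n →
    (α : Labeling r m n) → RankOne r α →
    ((p a : ℕ) → Prime p → 1 ≤ a → r ≡ p ^ a →
    AtLeastZeroEdges r α (6 * m * n ∸ 1))
    × ((p₁ p₂ a₁ a₂ : ℕ) → Prime p₁ → Prime p₂ → p₁ ≢ p₂ → 1 ≤ a₁ → 1 ≤ a₂ →
    r ≡ p₁ ^ a₁ * p₂ ^ a₂ →
    AtLeastZeroEdges r α (3 * m * n + m + n ∸ 2))
    × ((p₁ p₂ p₃ a₁ a₂ a₃ : ℕ) → Prime p₁ → Prime p₂ → Prime p₃ →
    p₁ ≢ p₂ → p₁ ≢ p₃ → p₂ ≢ p₃ → 1 ≤ a₁ → 1 ≤ a₂ → 1 ≤ a₃ →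
    r ≡ p₁ ^ a₁ * p₂ ^ a₂ * p₃ ^ a₃ →
    AtLeastZeroEdges r α (2 * m + 2 * n ∸ 3))
proposition5p1 (suc a) (suc b) r (s≤s z≤n) (s≤s z≤n) α rank-one =
    (λ _ e p-prime 1≤e r≡ →
       zero-edges-lower-bound r α rank-one (prime-power-detecting r e p-prime 1≤e r≡)
         (6 * suc a * suc b) (prime-power-counts a b))
  , (λ _ _ e₁ e₂ p₁-prime p₂-prime _ 1≤e₁ 1≤e₂ r≡ →
       zero-edges-lower-bound r α rank-one (two-primes-detecting r e₁ e₂ p₁-prime p₂-prime 1≤e₁ 1≤e₂ r≡)
         (3 * suc a * suc b + suc a + suc b) (two-primes-counts a b))
  , (λ _ _ _ e₁ e₂ e₃ p₁-prime p₂-prime p₃-prime _ _ _ 1≤e₁ 1≤e₂ 1≤e₃ r≡ →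
       zero-edges-lower-bound r α rank-one
         (three-primes-detecting r e₁ e₂ e₃ p₁-prime p₂-prime p₃-prime 1≤e₁ 1≤e₂ 1≤e₃ r≡)
         (2 * suc a + 2 * suc b) (three-primes-counts a b))
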